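{- Let $(G,T)$ be a graft that is a strong comb with respect to $r$ with tooth set $B$. Then $(G,T)$ has a connected minimum join covering $r$ if and only if $(G,T)$ is a rake with head $r$ and tooth set $B$.
   Context: Graphs are finite and may have loops and parallel edges; $N_G(X)$ is the set of vertices outside $X$ adjacent to $X$. A graft is a pair $(G,T)$, $T\subseteq V(G)$, with each connected component of $G$ containing an even number of vertices of $T$. A join is $F\subseteq E(G)$ with $|\delta_G(v)\cap F|$ odd for $v\in T$ and even for $v\notin T$; a minimum join has minimum cardinality; a join is connected if the subgraph formed by its edges is connected (the empty set is not connected); $F$ covers $v$ if an edge of $F$ is incident to $v$. For $F\subseteq E(G)$ let $w_F(e)=-1$ if $e\in F$ and $1$ otherwise, $w_F(P)=\sum_{e\in E(P)}w_F(e)$. For a minimum join $F$, $d_{(G,T)}(x,y)$ is the minimum of $w_F(P)$ over all paths $P$ between $x$ and $y$ (one-vertex path has weight $0$); it does not depend on the choice of minimum join (Sebő). A graft $(G,T)$ is a strong comb with respect to $r$ with tooth set $B$ if $B$ is stable with $N_G(B)=V(G)\setminus B$, $r\in V(G)\setminus B$, $d_{(G,T)}(r,x)=-1$ for all $x\in B$ and $d_{(G,T)}(r,x)=0$ for all $x\in V(G)\setminus B$. A graft is a rake with tooth set $B$ and head $r$ if $B\subseteq T$ is stable, $N_G(B)=V(G)\setminus B$, $r\in V(G)\setminus B$ is adjacent to every vertex of $B$, and $T=B\cup\{r\}$ if $|B|$ is odd, $T=B$ if $|B|$ is even. -}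

module Defs where

open import Data.Nat using (ℕ; _%_)
import Data.Nat as N
open import Data.Integer using (ℤ; _+_; _≤_; -[1+_]; +_)
open import Data.Fin using (Fin; _≟_)
open import Data.Fin.Subset using (Subset; _∈_; _∉_; _∩_; _∪_; ⁅_⁆; ∣_∣; _⊆_)
open import Data.Vec using (tabulate; lookup)
open import Data.Bool using (Bool; true; false; if_then_else_; _xor_)
open import Data.Product using (_×_; _,_; Σ; ∃; ∃-syntax; proj₁; proj₂)
open import Data.Sum using (_⊎_)
open import Data.Unit using (⊤)
open import Data.List using (List; []; _∷_)
open import Data.List.Relation.Unary.Unique.Propositional using (Unique)
open import Relation.Nullary using (does; ¬_)
open import Relation.Binary.PropositionalEquality using (_≡_)

-- A finite multigraph (loops and parallel edges allowed) on vertex set Fin n,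
-- with edge set Fin m; each edge has an (unordered) pair of ends.
record Graph (n : ℕ) : Set where
  field
    m    : ℕ
    ends : Fin m → Fin n × Fin n
open Graph public

module _ {n : ℕ} (G : Graph n) where

  EdgeSet : Set
  EdgeSet = Subset (m G)

  Joins : Fin (m G) → Fin n → Fin n → Set
  Joins e x y = (ends G e ≡ (x , y)) ⊎ (ends G e ≡ (y , x))

  Incident : Fin (m G) → Fin n → Set
  Incident e v = (proj₁ (ends G e) ≡ v) ⊎ (proj₂ (ends G e) ≡ v)

  data WalkIn (P : Fin (m G) → Set) (x : Fin n) : Fin n → Set where
    nil  : WalkIn P x x
    cons : ∀ {y z} (e : Fin (m G)) → P e → Joins e x y → WalkIn P y z → WalkIn P x z

  Walk : Fin n → Fin n → Set
  Walk = WalkIn (λ _ → ⊤)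

  vertices : ∀ {P x y} → WalkIn P x y → List (Fin n)
  vertices {x = x} nil = x ∷ []
  vertices {x = x} (cons e _ _ w) = x ∷ vertices w

  record Path (x y : Fin n) : Set where
    constructor path
    field
      walk     : Walk x y
      distinct : Unique (vertices walk)

  wt : EdgeSet → Fin (m G) → ℤ
  wt F e = if lookup F e then -[1+ 0 ] else + 1

  walkWeight : ∀ {P x y} → EdgeSet → WalkIn P x y → ℤ
  walkWeight F nil = + 0
  walkWeight F (cons e _ _ w) = wt F e + walkWeight F w

  pathWeight : ∀ {x y} → EdgeSet → Path x y → ℤ
  pathWeight F p = walkWeight F (Path.walk p)

  -- δ(v): edges with exactly one end equal to v (loops are not in any cut)
  δ : Fin n → EdgeSet
  δ v = tabulate (λ e → does (proj₁ (ends G e) ≟ v) xor does (proj₂ (ends G e) ≟ v))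

  Even Odd : ℕ → Set
  Even k = k % 2 ≡ 0
  Odd  k = k % 2 ≡ 1

  IsComponent : Subset n → Set
  IsComponent C = ∃[ x ] (x ∈ C × (∀ y → (y ∈ C → Walk x y) × (Walk x y → y ∈ C)))

  IsGraft : Subset n → Set
  IsGraft T = ∀ C → IsComponent C → Even ∣ C ∩ T ∣

  IsJoin : Subset n → EdgeSet → Set
  IsJoin T F = ∀ v → (v ∈ T → Odd ∣ F ∩ δ v ∣) × (v ∉ T → Even ∣ F ∩ δ v ∣)

  IsMinJoin : Subset n → EdgeSet → Set
  IsMinJoin T F = IsJoin T F × (∀ F' → IsJoin T F' → ∣ F ∣ N.≤ ∣ F' ∣)

  Covers : EdgeSet → Fin n → Set
  Covers F v = ∃[ e ] (e ∈ F × Incident e v)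

  IsConnectedEdgeSet : EdgeSet → Set
  IsConnectedEdgeSet F =
    (∃[ e ] e ∈ F) ×
    (∀ x y → Covers F x → Covers F y → WalkIn (λ e → e ∈ F) x y)

  IsMinPathWeight : EdgeSet → Fin n → Fin n → ℤ → Set
  IsMinPathWeight F x y k =
    (∃[ p ] pathWeight {x} {y} F p ≡ k) × (∀ (p : Path x y) → k ≤ pathWeight F p)

  -- d_(G,T)(x,y) = k, computed w.r.t. (any, equivalently every) minimum join F
  Dist : Subset n → Fin n → Fin n → ℤ → Set
  Dist T x y k = ∀ F → IsMinJoin T F → IsMinPathWeight F x y k

  Stable : Subset n → Set
  Stable B = ∀ e → ¬ (proj₁ (ends G e) ∈ B × proj₂ (ends G e) ∈ B)

  Adjacent : Fin n → Fin n → Set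
  Adjacent x y = ∃[ e ] Joins e x y

  -- N_G(B) = V(G) ∖ B   (neighbours are by definition outside B)
  NeighbourhoodIsComplement : Subset n → Set
  NeighbourhoodIsComplement B = ∀ v → v ∉ B → ∃[ b ] (b ∈ B × Adjacent v b)

  IsStrongComb : Subset n → Fin n → Subset n → Set
  IsStrongComb T r B =
    Stable B × NeighbourhoodIsComplement B × r ∉ B ×
    (∀ x → x ∈ B → Dist T r x -[1+ 0 ]) ×
    (∀ x → x ∉ B → Dist T r x (+ 0))

  IsRake : Subset n → Fin n → Subset n → Set
  IsRake T r B =
    B ⊆ T × Stable B × NeighbourhoodIsComplement B × r ∉ B ×
    (∀ b → b ∈ B → Adjacent r b) ×
    ((Odd ∣ B ∣ → T ≡ B ∪ ⁅ r ⁆) × (Even ∣ B ∣ → T ≡ B))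

-- In a strong comb every path from r has weight at least -1 with respect to a minimum join F.
-- Hence F contains no path of two edges starting at r (it would weigh -2), so a connected F
-- covering r is a star centred at r.  Its leaves lie in B because d(r,x) = 0 off B; each b in B
-- is reached by a path of weight -1, and since edges avoiding r are not in F such a path is a
-- single F-edge; minimality excludes loops and parallel edges.  So vertices of B have F-degree 1
-- and the others, apart from r, degree 0: T agrees with B off r, and the parity of |T| (the star
-- together with the dominating set B connects G) decides whether r is in T.  Conversely, in a
-- rake one edge from r to each vertex of B forms such a star, which is a join, and it is minimum
-- because B is stable: every join meets the vertices of B in pairwise distinct edges.
module Submission where

open import Defs
open import Data.Nat using (ℕ; zero; suc; _≤_; _<_; _%_; z≤n; s≤s)
open import Data.Nat.Properties using (≤-antisym; <⇒≱; <-trans)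
open import Data.Fin using (Fin; zero; suc; _≟_)
open import Data.Fin.Properties using (suc-injective; any?)
open import Data.Fin.Subset
  using (Subset; _∈_; _∉_; _∩_; _∪_; _─_; _-_; ⁅_⁆; ∣_∣; _⊆_; ⊤; inside; outside; Nonempty; Empty)
open import Data.Fin.Subset.Properties
  using (_∈?_; ∈⊤; ⊆-antisym; p─q⊆p; p─⊥≡p; x∈p∧x≢y⇒x∈p-y; x∈p⇒∣p-x∣<∣p∣; x∈⁅x⁆; x∈⁅y⁆⇒x≡y;
         x∈p∩q⁺; x∈p∩q⁻; x∈p∪q⁺; x∈p∪q⁻; p∩q⊆p; ∩-identityˡ; Empty-unique; ∣⊥∣≡0; nonempty?)
open import Data.Vec using ([]; _∷_; lookup; tabulate; here; there)
open import Data.Vec.Properties using ([]=⇒lookup; lookup⇒[]=; lookup∘tabulate)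
open import Data.Bool using (Bool; true; false; _∧_; _xor_)
open import Data.Bool.Properties using (T-≡)
open import Data.Product using (_×_; _,_; ∃-syntax; proj₁; proj₂)
open import Data.Product.Properties using (≡-dec)
open import Data.Maybe using (Maybe; just; nothing)
open import Data.Maybe.Properties using (just-injective) renaming (≡-dec to maybe-≡-dec)
open import Data.Integer using (+_; -[1+_]; _+_; -≤-; -≤+) renaming (_≤_ to _≤ℤ_)
open import Data.Integer.Properties using () renaming (≤-trans to ≤ℤ-trans)
open import Data.List.Relation.Unary.All using (All; []; _∷_)
open import Data.List.Relation.Unary.AllPairs using ([]; _∷_)
open import Data.List.Relation.Unary.Unique.Propositional using (Unique)
open import Data.Unit using (tt)
open import Data.Sum using (_⊎_; inj₁; inj₂)
open import Data.Empty using (⊥; ⊥-elim)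
open import Function using (_∘_; case_of_; _⇔_; mk⇔; Equivalence)
open import Relation.Nullary using (¬_; Dec; yes; no; does; contradiction)
open import Relation.Nullary.Decidable using (_⊎-dec_; _×-dec_; dec-true; dec-false; toWitness; isYes≗does)
open import Relation.Unary using (Pred; Decidable)
open import Relation.Binary.PropositionalEquality

-- Finite subsets

private variable
  k l : ℕ
  x y : Fin k
  p : Subset k

x∉p-x : ∀ (p : Subset k) → x ∉ p - x
x∉p-x {x = zero}  (s ∷ p) ()
x∉p-x {x = suc x} (s ∷ p) (there x∈p-x) = x∉p-x p x∈p-x

x∈p⇒∣p∣≡1+∣p-x∣ : x ∈ p → ∣ p ∣ ≡ suc ∣ p - x ∣
x∈p⇒∣p∣≡1+∣p-x∣ {p = inside ∷ p}  here          = cong suc (cong ∣_∣ (sym (p─⊥≡p p)))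
x∈p⇒∣p∣≡1+∣p-x∣ {p = inside ∷ p}  (there x∈p) = cong suc (x∈p⇒∣p∣≡1+∣p-x∣ x∈p)
x∈p⇒∣p∣≡1+∣p-x∣ {p = outside ∷ p} (there x∈p) = x∈p⇒∣p∣≡1+∣p-x∣ x∈p

x∉p⇒p-x≡p : x ∉ p → p - x ≡ p
x∉p⇒p-x≡p {p = p} x∉p =
  ⊆-antisym (p─q⊆p p _) (λ y∈p → x∈p∧x≢y⇒x∈p-y y∈p λ { refl → x∉p y∈p })

─-∩-comm : ∀ (p q r : Subset k) → (p ─ r) ∩ q ≡ (p ∩ q) ─ r
─-∩-comm []      []      []            = refl
─-∩-comm (a ∷ p) (b ∷ q) (inside  ∷ r) = cong (outside ∷_) (─-∩-comm p q r)
─-∩-comm (a ∷ p) (b ∷ q) (outside ∷ r) = cong (a ∧ b ∷_) (─-∩-comm p q r)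

∣p∣≡2+∣p-x-y∣ : x ∈ p → y ∈ p → x ≢ y → ∣ p ∣ ≡ suc (suc ∣ p - x - y ∣)
∣p∣≡2+∣p-x-y∣ x∈p y∈p x≢y =
  trans (x∈p⇒∣p∣≡1+∣p-x∣ x∈p) (cong suc (x∈p⇒∣p∣≡1+∣p-x∣ (x∈p∧x≢y⇒x∈p-y y∈p (x≢y ∘ sym))))

Empty⇒∣p∣≡0 : ∀ {k} {p : Subset k} → Empty p → ∣ p ∣ ≡ 0
Empty⇒∣p∣≡0 {k} p-empty = trans (cong ∣_∣ (Empty-unique p-empty)) (∣⊥∣≡0 k)

∣p∣≡1 : x ∈ p → (∀ {y} → y ∈ p → y ≡ x) → ∣ p ∣ ≡ 1
∣p∣≡1 {x = x} {p = p} x∈p unique = trans (x∈p⇒∣p∣≡1+∣p-x∣ x∈p) (cong suc (Empty⇒∣p∣≡0 p-x-empty))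
  where
  p-x-empty : Empty (p - x)
  p-x-empty (y , y∈p-x) with unique (p─q⊆p p _ y∈p-x)
  ... | refl = x∉p-x p y∈p-x

∣p∣≢0⇒Nonempty : ¬ ∣ p ∣ ≡ 0 → Nonempty p
∣p∣≢0⇒Nonempty {p = p} ∣p∣≢0 with nonempty? p
... | yes ne = ne
... | no  ¬ne = contradiction (Empty⇒∣p∣≡0 ¬ne) ∣p∣≢0

∣p∪⁅x⁆∣≡1+∣p∣ : x ∉ p → ∣ p ∪ ⁅ x ⁆ ∣ ≡ suc ∣ p ∣
∣p∪⁅x⁆∣≡1+∣p∣ {x = x} {p = p} x∉p = begin
  ∣ p ∪ ⁅ x ⁆ ∣            ≡⟨ x∈p⇒∣p∣≡1+∣p-x∣ (x∈p∪q⁺ {p = p} (inj₂ (x∈⁅x⁆ x))) ⟩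
  suc ∣ (p ∪ ⁅ x ⁆) - x ∣  ≡⟨ cong (suc ∘ ∣_∣) p∪⁅x⁆-x≡p ⟩
  suc ∣ p ∣                ∎
  where
  open ≡-Reasoning
  p∪⁅x⁆-x≡p : (p ∪ ⁅ x ⁆) - x ≡ p
  p∪⁅x⁆-x≡p = ⊆-antisym
    (λ {y} y∈ → case x∈p∪q⁻ p ⁅ x ⁆ (p─q⊆p _ _ y∈) of λ
      { (inj₁ y∈p)   → y∈p
      ; (inj₂ y∈⁅x⁆) → contradiction (subst (_∈ _) (x∈⁅y⁆⇒x≡y x y∈⁅x⁆) y∈) (x∉p-x _) })
    (λ y∈p → x∈p∧x≢y⇒x∈p-y (x∈p∪q⁺ (inj₁ y∈p)) λ { refl → x∉p y∈p })

injection⇒∣p∣≤∣q∣ : ∀ {p : Subset k} {q : Subset l} (f : ∀ {x} → x ∈ p → Fin l) →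
  (∀ {x} (x∈p : x ∈ p) → f x∈p ∈ q) →
  (∀ {x y} (x∈p : x ∈ p) (y∈p : y ∈ p) → f x∈p ≡ f y∈p → x ≡ y) →
  ∣ p ∣ ≤ ∣ q ∣
injection⇒∣p∣≤∣q∣ {p = []} f f∈q f-inj = z≤n
injection⇒∣p∣≤∣q∣ {p = outside ∷ p} f f∈q f-inj =
  injection⇒∣p∣≤∣q∣ (f ∘ there) (f∈q ∘ there) λ x∈p y∈p → suc-injective ∘ f-inj (there x∈p) (there y∈p)
injection⇒∣p∣≤∣q∣ {p = inside ∷ p} {q = q} f f∈q f-inj =
  subst (suc ∣ p ∣ ≤_) (sym (x∈p⇒∣p∣≡1+∣p-x∣ (f∈q here)))
    (s≤s (injection⇒∣p∣≤∣q∣ (f ∘ there) f∈q-f₀ λ x∈p y∈p → suc-injective ∘ f-inj (there x∈p) (there y∈p)))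
  where
  f∈q-f₀ : ∀ {x} (x∈p : x ∈ p) → f (there x∈p) ∈ q - f here
  f∈q-f₀ x∈p = x∈p∧x≢y⇒x∈p-y (f∈q (there x∈p)) λ eq → case f-inj (there x∈p) here eq of λ ()

∈tabulate⇔ : ∀ {k} {f : Fin k → Bool} {x} → x ∈ tabulate f ⇔ f x ≡ true
∈tabulate⇔ {f = f} {x} = mk⇔
  (λ x∈ → trans (sym (lookup∘tabulate f x)) ([]=⇒lookup x∈))
  (λ fx → lookup⇒[]= x (tabulate f) (trans (lookup∘tabulate f x) fx))

satisfying : ∀ {k ℓ} {P : Pred (Fin k) ℓ} → Decidable P → Subset k
satisfying P? = tabulate (does ∘ P?)

∈satisfying⇔ : ∀ {k ℓ} {P : Pred (Fin k) ℓ} (P? : Decidable P) {x} → x ∈ satisfying P? ⇔ P x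
∈satisfying⇔ P? {x} = mk⇔
  (λ x∈ → toWitness (Equivalence.from T-≡ (trans (isYes≗does (P? x)) (Equivalence.to ∈tabulate⇔ x∈))))
  (λ Px → Equivalence.from ∈tabulate⇔ (dec-true (P? x) Px))

parity : ∀ k → k % 2 ≡ 0 ⊎ k % 2 ≡ 1
parity zero          = inj₁ refl
parity (suc zero)    = inj₂ refl
parity (suc (suc k)) = parity k

even-suc⇒¬even : ∀ k → suc k % 2 ≡ 0 → ¬ k % 2 ≡ 0
even-suc⇒¬even zero          ()
even-suc⇒¬even (suc zero)    _  ()
even-suc⇒¬even (suc (suc k)) e  = even-suc⇒¬even k e

-- Edges, cuts and walks

module _ {n : ℕ} (G : Graph n) where

  Joins-sym : ∀ {e x y} → Joins G e x y → Joins G e y x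
  Joins-sym (inj₁ eq) = inj₂ eq
  Joins-sym (inj₂ eq) = inj₁ eq

  Joins-ends : ∀ e → Joins G e (proj₁ (ends G e)) (proj₂ (ends G e))
  Joins-ends e = inj₁ refl

  Joins-unique : ∀ {e x y u v} → Joins G e x y → Joins G e u v → (u ≡ x × v ≡ y) ⊎ (u ≡ y × v ≡ x)
  Joins-unique (inj₁ p) (inj₁ q) with trans (sym q) p
  ... | refl = inj₁ (refl , refl)
  Joins-unique (inj₁ p) (inj₂ q) with trans (sym q) p
  ... | refl = inj₂ (refl , refl)
  Joins-unique (inj₂ p) (inj₁ q) with trans (sym q) p
  ... | refl = inj₂ (refl , refl)
  Joins-unique (inj₂ p) (inj₂ q) with trans (sym q) p
  ... | refl = inj₁ (refl , refl)

  Joins-unique-end : ∀ {e x y y'} → y ≢ x → Joins G e x y → Joins G e x y' → y' ≡ y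
  Joins-unique-end y≢x e-xy e-xy' with Joins-unique e-xy e-xy'
  ... | inj₁ (_ , y'≡y)     = y'≡y
  ... | inj₂ (x≡y , _)      = contradiction (sym x≡y) y≢x

  joins? : ∀ e x y → Dec (Joins G e x y)
  joins? e x y = ≡-dec _≟_ _≟_ (ends G e) (x , y) ⊎-dec ≡-dec _≟_ _≟_ (ends G e) (y , x)

  Joins⇒Incident : ∀ {e x y} → Joins G e x y → Incident G e x
  Joins⇒Incident (inj₁ eq) = inj₁ (cong proj₁ eq)
  Joins⇒Incident (inj₂ eq) = inj₂ (cong proj₂ eq)

  Incident⇒end : ∀ {e v x y} → Incident G e v → Joins G e x y → v ≡ x ⊎ v ≡ y
  Incident⇒end (inj₁ p) (inj₁ q) = inj₁ (trans (sym p) (cong proj₁ q))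
  Incident⇒end (inj₁ p) (inj₂ q) = inj₂ (trans (sym p) (cong proj₁ q))
  Incident⇒end (inj₂ p) (inj₁ q) = inj₂ (trans (sym p) (cong proj₂ q))
  Incident⇒end (inj₂ p) (inj₂ q) = inj₁ (trans (sym p) (cong proj₂ q))

  ∈δ⁻ : ∀ {e v} → e ∈ δ G v → ∃[ u ] (Joins G e v u × u ≢ v)
  ∈δ⁻ {e} {v} e∈δv
    with proj₁ (ends G e) ≟ v | proj₂ (ends G e) ≟ v | Equivalence.to ∈tabulate⇔ e∈δv
  ... | yes a≡v | no  b≢v | _ = _ , inj₁ (cong₂ _,_ a≡v refl) , b≢v
  ... | no  a≢v | yes b≡v | _ = _ , inj₂ (cong₂ _,_ refl b≡v) , a≢v

  ∈δ⁺ : ∀ {e v u} → Joins G e v u → u ≢ v → e ∈ δ G v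
  ∈δ⁺ {e} {v} {u} e-vu u≢v = Equivalence.from ∈tabulate⇔ (cut e-vu)
    where
    cut : Joins G e v u → does (proj₁ (ends G e) ≟ v) xor does (proj₂ (ends G e) ≟ v) ≡ true
    cut (inj₁ eq) rewrite eq | dec-true (v ≟ v) refl | dec-false (u ≟ v) u≢v = refl
    cut (inj₂ eq) rewrite eq | dec-true (v ≟ v) refl | dec-false (u ≟ v) u≢v = refl

  ∈δ⇒end : ∀ {e v x y} → e ∈ δ G v → Joins G e x y → v ≡ x ⊎ v ≡ y
  ∈δ⇒end e∈δv e-xy with ∈δ⁻ e∈δv
  ... | _ , e-vu , _ with Joins-unique e-xy e-vu
  ... | inj₁ (v≡x , _) = inj₁ v≡x
  ... | inj₂ (v≡y , _) = inj₂ v≡y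

  loop∉δ : ∀ {e x v} → Joins G e x x → e ∉ δ G v
  loop∉δ e-xx e∈δv with ∈δ⁻ e∈δv
  ... | _ , e-vu , u≢v with Joins-unique e-xx e-vu
  ... | inj₁ (refl , refl) = u≢v refl
  ... | inj₂ (refl , refl) = u≢v refl

  ∈δ-parallel : ∀ {e e' x y v} → Joins G e x y → Joins G e' x y → e ∈ δ G v → e' ∈ δ G v
  ∈δ-parallel e-xy e'-xy e∈δv with ∈δ⁻ e∈δv
  ... | _ , e-vu , u≢v with Joins-unique e-xy e-vu
  ... | inj₁ (refl , refl) = ∈δ⁺ e'-xy u≢v
  ... | inj₂ (refl , refl) = ∈δ⁺ (Joins-sym e'-xy) u≢v

  ∈δ∩δ⇒Joins : ∀ {e x y} → e ∈ δ G x → e ∈ δ G y → x ≢ y → Joins G e x y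
  ∈δ∩δ⇒Joins e∈δx e∈δy x≢y with ∈δ⁻ e∈δx
  ... | _ , e-xu , _ with ∈δ⇒end e∈δy e-xu
  ... | inj₁ y≡x = contradiction (sym y≡x) x≢y
  ... | inj₂ refl = e-xu

  Stable⇒¬Joins : ∀ {B e x y} → Stable G B → x ∈ B → y ∈ B → ¬ Joins G e x y
  Stable⇒¬Joins {B} {e} stable x∈B y∈B (inj₁ eq) =
    stable e (subst (λ (a , b) → a ∈ B × b ∈ B) (sym eq) (x∈B , y∈B))
  Stable⇒¬Joins {B} {e} stable x∈B y∈B (inj₂ eq) =
    stable e (subst (λ (a , b) → a ∈ B × b ∈ B) (sym eq) (y∈B , x∈B))

  _++ʷ_ : ∀ {P x y z} → WalkIn G P x y → WalkIn G P y z → WalkIn G P x z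
  nil             ++ʷ w' = w'
  cons e Pe e-xy w ++ʷ w' = cons e Pe e-xy (w ++ʷ w')

  length : ∀ {P x y} → WalkIn G P x y → ℕ
  length nil             = 0
  length (cons _ _ _ w) = suc (length w)

  length≡0⇒≡ : ∀ {P x y} (w : WalkIn G P x y) → length w ≡ 0 → x ≡ y
  length≡0⇒≡ nil _ = refl

  All-start : ∀ {ℓ} {Q : Pred (Fin n) ℓ} {P x y} (w : WalkIn G P x y) → All Q (vertices G w) → Q x
  All-start nil             (Qx ∷ _) = Qx
  All-start (cons _ _ _ _) (Qx ∷ _) = Qx

  edgePath : ∀ {e x y} → Joins G e x y → x ≢ y → Path G x y
  edgePath {e} e-xy x≢y = path (cons e tt e-xy nil) ((x≢y ∷ []) ∷ [] ∷ [])

  twoEdgePath : ∀ {e f x y z} → Joins G e x y → Joins G f y z → x ≢ y → x ≢ z → y ≢ z → Path G x z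
  twoEdgePath {e} {f} e-xy f-yz x≢y x≢z y≢z =
    path (cons e tt e-xy (cons f tt f-yz nil)) ((x≢y ∷ x≢z ∷ []) ∷ (y≢z ∷ []) ∷ [] ∷ [])

  wt-∈ : ∀ {F e} → e ∈ F → wt G F e ≡ -[1+ 0 ]
  wt-∈ e∈F rewrite []=⇒lookup e∈F = refl

  wt-∉ : ∀ {F e} → e ∉ F → wt G F e ≡ + 1
  wt-∉ {F} {e} e∉F with lookup F e in F[e]
  ... | true  = contradiction (lookup⇒[]= e F F[e]) e∉F
  ... | false = refl

  wt+k≡-1 : ∀ {F e} k → wt G F e + + k ≡ -[1+ 0 ] → e ∈ F × k ≡ 0
  wt+k≡-1 {F} {e} k eq with e ∈? F
  ... | no  e∉F = case trans (sym (cong (_+ + k) (wt-∉ e∉F))) eq of λ ()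
  ... | yes e∈F with k
  ...   | zero  = e∈F , refl
  ...   | suc j = case trans (sym (cong (_+ + suc j) (wt-∈ e∈F))) eq of λ ()

  -- Minimum joins

  IsJoin-resp-parity : ∀ {T} F F' → IsJoin G T F →
    (∀ v → ∣ F' ∩ δ G v ∣ % 2 ≡ ∣ F ∩ δ G v ∣ % 2) → IsJoin G T F'
  IsJoin-resp-parity F F' join same v =
    (λ v∈T → trans (same v) (proj₁ (join v) v∈T)) , (λ v∉T → trans (same v) (proj₂ (join v) v∉T))

  -∩δ-comm : ∀ F e v → (F - e) ∩ δ G v ≡ (F ∩ δ G v) - e
  -∩δ-comm F e v = ─-∩-comm F (δ G v) ⁅ e ⁆

  minJoin-loopless : ∀ {T F e x} → IsMinJoin G T F → e ∈ F → ¬ Joins G e x x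
  minJoin-loopless {T} {F} {e} (join , minimal) e∈F e-xx =
    <⇒≱ (x∈p⇒∣p-x∣<∣p∣ e∈F) (minimal (F - e) (IsJoin-resp-parity F (F - e) join same-parity))
    where
    cut : ∀ v → (F - e) ∩ δ G v ≡ F ∩ δ G v
    cut v = trans (-∩δ-comm F e v) (x∉p⇒p-x≡p (loop∉δ e-xx ∘ proj₂ ∘ x∈p∩q⁻ F (δ G v)))
    same-parity : ∀ v → ∣ (F - e) ∩ δ G v ∣ % 2 ≡ ∣ F ∩ δ G v ∣ % 2
    same-parity v = cong (λ A → ∣ A ∣ % 2) (cut v)

  minJoin-simple : ∀ {T F e e' x y} → IsMinJoin G T F → e ∈ F → e' ∈ F →
    Joins G e x y → Joins G e' x y → e ≡ e'
  minJoin-simple {T} {F} {e} {e'} (join , minimal) e∈F e'∈F e-xy e'-xy with e ≟ e'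
  ... | yes e≡e' = e≡e'
  ... | no  e≢e' =
    contradiction (minimal (F - e - e') (IsJoin-resp-parity F (F - e - e') join same-parity)) (<⇒≱ smaller)
    where
    smaller : ∣ F - e - e' ∣ < ∣ F ∣
    smaller = <-trans (x∈p⇒∣p-x∣<∣p∣ (x∈p∧x≢y⇒x∈p-y e'∈F (e≢e' ∘ sym))) (x∈p⇒∣p-x∣<∣p∣ e∈F)
    cut : ∀ v → (F - e - e') ∩ δ G v ≡ (F ∩ δ G v) - e - e'
    cut v = trans (-∩δ-comm (F - e) e' v) (cong (_- e') (-∩δ-comm F e v))
    same-parity : ∀ v → ∣ (F - e - e') ∩ δ G v ∣ % 2 ≡ ∣ F ∩ δ G v ∣ % 2
    same-parity v rewrite cut v with e ∈? δ G v
    -- in this case the two parities are those of 2 + k and k, equal by computation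
    ... | yes e∈δv = cong (_% 2) (sym (∣p∣≡2+∣p-x-y∣ (x∈p∩q⁺ (e∈F , e∈δv))
                                         (x∈p∩q⁺ (e'∈F , ∈δ-parallel e-xy e'-xy e∈δv)) e≢e'))
    ... | no  e∉δv = cong (λ A → ∣ A ∣ % 2)
      (trans (cong (_- e') (x∉p⇒p-x≡p (e∉δv ∘ proj₂ ∘ x∈p∩q⁻ F _)))
             (x∉p⇒p-x≡p (e∉δv ∘ ∈δ-parallel e'-xy e-xy ∘ proj₂ ∘ x∈p∩q⁻ F _)))

  stable⇒∣B∣≤∣F∣ : ∀ {T B F} → Stable G B → B ⊆ T → IsJoin G T F → ∣ B ∣ ≤ ∣ F ∣
  stable⇒∣B∣≤∣F∣ {T} {B} {F} stable B⊆T join = injection⇒∣p∣≤∣q∣ edgeAt (proj₁ ∘ edgeAt∈F∩δ) edgeAt-injective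
    where
    meets : ∀ {b} → b ∈ B → Nonempty (F ∩ δ G b)
    meets b∈B = ∣p∣≢0⇒Nonempty λ ∣F∩δb∣≡0 →
      case trans (sym (cong (_% 2) ∣F∩δb∣≡0)) (proj₁ (join _) (B⊆T b∈B)) of λ ()
    edgeAt : ∀ {b} → b ∈ B → Fin (m G)
    edgeAt = proj₁ ∘ meets
    edgeAt∈F∩δ : ∀ {b} (b∈B : b ∈ B) → edgeAt b∈B ∈ F × edgeAt b∈B ∈ δ G b
    edgeAt∈F∩δ b∈B = x∈p∩q⁻ F (δ G _) (proj₂ (meets b∈B))
    edgeAt-injective : ∀ {b b'} (b∈B : b ∈ B) (b'∈B : b' ∈ B) → edgeAt b∈B ≡ edgeAt b'∈B → b ≡ b'
    edgeAt-injective {b} {b'} b∈B b'∈B eq with b ≟ b'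
    ... | yes b≡b' = b≡b'
    ... | no  b≢b' = contradiction
      (∈δ∩δ⇒Joins (proj₂ (edgeAt∈F∩δ b∈B)) (subst (_∈ δ G b') (sym eq) (proj₂ (edgeAt∈F∩δ b'∈B))) b≢b')
      (Stable⇒¬Joins stable b∈B b'∈B)

  -- Stars centred at r with leaves B

  record IsStar (r : Fin n) (B : Subset n) (F : EdgeSet G) : Set where
    field
      spoke        : ∀ {e} → e ∈ F → ∃[ b ] (b ∈ B × Joins G e r b)
      spokeTo      : ∀ {b} → b ∈ B → ∃[ e ] (e ∈ F × Joins G e r b)
      spoke-unique : ∀ {e e' b} → e ∈ F → e' ∈ F → Joins G e r b → Joins G e' r b → e ≡ e'

  module Star {r B F} (r∉B : r ∉ B) (star : IsStar r B F) where
    open IsStar star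

    leaf≢centre : ∀ {b} → b ∈ B → b ≢ r
    leaf≢centre b∈B refl = r∉B b∈B

    degree-leaf : ∀ {b} → b ∈ B → ∣ F ∩ δ G b ∣ ≡ 1
    degree-leaf {b} b∈B with spokeTo b∈B
    ... | e , e∈F , e-rb = ∣p∣≡1 (x∈p∩q⁺ (e∈F , ∈δ⁺ (Joins-sym e-rb) (leaf≢centre b∈B ∘ sym))) only-spoke
      where
      only-spoke : ∀ {e'} → e' ∈ F ∩ δ G b → e' ≡ e
      only-spoke e'∈F∩δb with x∈p∩q⁻ F (δ G b) e'∈F∩δb
      ... | e'∈F , e'∈δb with spoke e'∈F
      ... | _ , _ , e'-rb' with ∈δ⇒end e'∈δb e'-rb'
      ... | inj₁ b≡r  = contradiction b≡r (leaf≢centre b∈B)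
      ... | inj₂ refl = spoke-unique e'∈F e∈F e'-rb' e-rb

    degree-other : ∀ {v} → v ∉ B → v ≢ r → ∣ F ∩ δ G v ∣ ≡ 0
    degree-other {v} v∉B v≢r = Empty⇒∣p∣≡0 λ (e , e∈F∩δv) → meets-spoke (x∈p∩q⁻ F (δ G v) e∈F∩δv)
      where
      meets-spoke : ∀ {e} → e ∈ F × e ∈ δ G v → ⊥
      meets-spoke (e∈F , e∈δv) with spoke e∈F
      ... | _ , b∈B , e-rb with ∈δ⇒end e∈δv e-rb
      ... | inj₁ v≡r  = v≢r v≡r
      ... | inj₂ refl = v∉B b∈B

    size : ∣ F ∣ ≡ ∣ B ∣
    size = ≤-antisym
      (injection⇒∣p∣≤∣q∣ (proj₁ ∘ spoke) (proj₁ ∘ proj₂ ∘ spoke) λ e∈F e'∈F eq →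
        spoke-unique e∈F e'∈F (proj₂ (proj₂ (spoke e∈F))) (subst (Joins G _ r) (sym eq) (proj₂ (proj₂ (spoke e'∈F)))))
      (injection⇒∣p∣≤∣q∣ (proj₁ ∘ spokeTo) (proj₁ ∘ proj₂ ∘ spokeTo) λ b∈B b'∈B eq →
        Joins-unique-end (leaf≢centre b'∈B)
          (proj₂ (proj₂ (spokeTo b'∈B))) (subst (λ e → Joins G e r _) eq (proj₂ (proj₂ (spokeTo b∈B)))))

    degree-centre : ∣ F ∩ δ G r ∣ ≡ ∣ B ∣
    degree-centre = trans (cong ∣_∣ F∩δr≡F) size
      where
      F∩δr≡F : F ∩ δ G r ≡ F
      F∩δr≡F = ⊆-antisym (p∩q⊆p F (δ G r)) λ e∈F →
        let (_ , b∈B , e-rb) = spoke e∈F in x∈p∩q⁺ (e∈F , ∈δ⁺ e-rb (leaf≢centre b∈B))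

    toCentre : ∀ {v} → Covers G F v → WalkIn G (_∈ F) v r
    toCentre (e , e∈F , e∋v) with spoke e∈F
    ... | _ , _ , e-rb with Incident⇒end e∋v e-rb
    ... | inj₁ refl = nil
    ... | inj₂ refl = cons e e∈F (Joins-sym e-rb) nil

    fromCentre : ∀ {v} → Covers G F v → WalkIn G (_∈ F) r v
    fromCentre (e , e∈F , e∋v) with spoke e∈F
    ... | _ , _ , e-rb with Incident⇒end e∋v e-rb
    ... | inj₁ refl = nil
    ... | inj₂ refl = cons e e∈F e-rb nil

    connected : Nonempty B → IsConnectedEdgeSet G F
    connected (_ , b∈B) =
      (proj₁ (spokeTo b∈B) , proj₁ (proj₂ (spokeTo b∈B))) ,
      λ x y x-covered y-covered → toCentre x-covered ++ʷ fromCentre y-covered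

    covers-centre : Nonempty B → Covers G F r
    covers-centre (_ , b∈B) =
      let (e , e∈F , e-rb) = spokeTo b∈B in e , e∈F , Joins⇒Incident e-rb

  module StrongCombJoin
    {T r B} (r∉B : r ∉ B)
    (dist-B : ∀ x → x ∈ B → Dist G T r x -[1+ 0 ])
    (dist-rest : ∀ x → x ∉ B → Dist G T r x (+ 0))
    {F} (minJoin : IsMinJoin G T F) (F-connected : IsConnectedEdgeSet G F) (r-covered : Covers G F r)
    where

    -1≤weight : ∀ {x} (P : Path G r x) → -[1+ 0 ] ≤ℤ pathWeight G F P
    -1≤weight {x} P with x ∈? B
    ... | yes x∈B = proj₂ (dist-B x x∈B F minJoin) P
    ... | no  x∉B = ≤ℤ-trans -≤+ (proj₂ (dist-rest x x∉B F minJoin) P)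

    F-leaf∈B : ∀ {e x} → e ∈ F → Joins G e r x → x ≢ r → x ∈ B
    F-leaf∈B {e} {x} e∈F e-rx x≢r with x ∈? B
    ... | yes x∈B = x∈B
    ... | no  x∉B = case subst (+ 0 ≤ℤ_) (cong (_+ + 0) (wt-∈ e∈F))
                           (proj₂ (dist-rest x x∉B F minJoin) (edgePath e-rx (x≢r ∘ sym))) of λ ()

    no-F-path₂ : ∀ {f e u y} → f ∈ F → Joins G f r u → e ∈ F → Joins G e u y → r ≢ u → r ≢ y → u ≢ y → ⊥
    no-F-path₂ f∈F f-ru e∈F e-uy r≢u r≢y u≢y =
      case subst (-[1+ 0 ] ≤ℤ_) (cong₂ _+_ (wt-∈ f∈F) (cong (_+ + 0) (wt-∈ e∈F)))
                 (-1≤weight (twoEdgePath f-ru e-uy r≢u r≢y u≢y)) of λ { (-≤- ()) }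

    NearCentre : Fin n → Set
    NearCentre u = u ≡ r ⊎ ∃[ f ] (f ∈ F × Joins G f r u × r ≢ u)

    NearCentre-step : ∀ {u e y} → NearCentre u → e ∈ F → Joins G e u y → NearCentre y
    NearCentre-step {u} {e} {y} near e∈F e-uy with r ≟ y
    ... | yes r≡y = inj₁ (sym r≡y)
    ... | no  r≢y with near
    ...   | inj₁ refl = inj₂ (e , e∈F , e-uy , r≢y)
    ...   | inj₂ (f , f∈F , f-ru , r≢u) with u ≟ y
    ...     | yes refl = inj₂ (f , f∈F , f-ru , r≢u)
    ...     | no  u≢y  = ⊥-elim (no-F-path₂ f∈F f-ru e∈F e-uy r≢u r≢y u≢y)

    NearCentre-walk : ∀ {u y} → NearCentre u → WalkIn G (_∈ F) u y → NearCentre y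
    NearCentre-walk near nil                   = near
    NearCentre-walk near (cons e e∈F e-uy w) = NearCentre-walk (NearCentre-step near e∈F e-uy) w

    F-edge-at-centre : ∀ {e x y} → e ∈ F → Joins G e x y → x ≢ y → x ≡ r ⊎ y ≡ r
    F-edge-at-centre {e} {x} {y} e∈F e-xy x≢y
      with NearCentre-walk (inj₁ refl) (proj₂ F-connected r x r-covered (e , e∈F , Joins⇒Incident e-xy))
    ... | inj₁ x≡r = inj₁ x≡r
    ... | inj₂ (f , f∈F , f-rx , r≢x) with r ≟ y
    ...   | yes r≡y = inj₂ (sym r≡y)
    ...   | no  r≢y = ⊥-elim (no-F-path₂ f∈F f-rx e∈F e-xy r≢x r≢y x≢y)

    weight-avoiding-centre : ∀ {x y} (w : Walk G x y) → Unique (vertices G w) →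
      All (r ≢_) (vertices G w) → walkWeight G F w ≡ + length w
    weight-avoiding-centre nil _ _ = refl
    weight-avoiding-centre (cons e _ e-xy w) (x∉w ∷ unique) (r≢x ∷ r∉w) =
      cong₂ _+_ (wt-∉ e∉F) (weight-avoiding-centre w unique r∉w)
      where
      e∉F : e ∉ F
      e∉F e∈F with F-edge-at-centre e∈F e-xy (All-start w x∉w)
      ... | inj₁ x≡r = r≢x (sym x≡r)
      ... | inj₂ y≡r = All-start w r∉w (sym y≡r)

    spokeTo : ∀ {b} → b ∈ B → ∃[ e ] (e ∈ F × Joins G e r b)
    spokeTo {b} b∈B with proj₁ (dist-B b b∈B F minJoin)
    ... | path nil _ , _ = contradiction b∈B r∉B
    ... | path (cons e _ e-ry w) (r∉w ∷ unique) , weight≡-1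
      with wt+k≡-1 (length w) (trans (cong (_+_ (wt G F e)) (sym (weight-avoiding-centre w unique r∉w))) weight≡-1)
    ...   | e∈F , length≡0 = e , e∈F , subst (Joins G e r) (length≡0⇒≡ w length≡0) e-ry

    F-edge-is-spoke : ∀ {e x y} → e ∈ F → Joins G e x y → x ≢ y → ∃[ b ] (b ∈ B × Joins G e r b)
    F-edge-is-spoke e∈F e-xy x≢y with F-edge-at-centre e∈F e-xy x≢y
    ... | inj₁ refl = _ , F-leaf∈B e∈F e-xy (x≢y ∘ sym) , e-xy
    ... | inj₂ refl = _ , F-leaf∈B e∈F (Joins-sym e-xy) x≢y , Joins-sym e-xy

    isStar : IsStar r B F
    isStar = record
      { spoke        = spoke
      ; spokeTo      = spokeTo
      ; spoke-unique = minJoin-simple minJoin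
      }
      where
      spoke : ∀ {e} → e ∈ F → ∃[ b ] (b ∈ B × Joins G e r b)
      spoke {e} e∈F with proj₁ (ends G e) ≟ proj₂ (ends G e)
      ... | yes x≡y = ⊥-elim (minJoin-loopless minJoin e∈F (subst (Joins G e _) (sym x≡y) (Joins-ends e)))
      ... | no  x≢y = F-edge-is-spoke e∈F (Joins-ends e) x≢y

  module StarJoin {T r B F} (graft : IsGraft G T) (r∉B : r ∉ B) (dominating : NeighbourhoodIsComplement G B)
    (star : IsStar r B F) (join : IsJoin G T F) where
    open IsStar star
    open Star r∉B star

    B⊆T : B ⊆ T
    B⊆T {b} b∈B with b ∈? T
    ... | yes b∈T = b∈T
    ... | no  b∉T = case trans (sym (cong (_% 2) (degree-leaf b∈B))) (proj₂ (join b) b∉T) of λ ()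

    T∖r⊆B : ∀ {v} → v ∈ T → v ≢ r → v ∈ B
    T∖r⊆B {v} v∈T v≢r with v ∈? B
    ... | yes v∈B = v∈B
    ... | no  v∉B = case trans (sym (cong (_% 2) (degree-other v∉B v≢r))) (proj₁ (join v) v∈T) of λ ()

    walkFromCentre : ∀ v → Walk G r v
    walkFromCentre v with v ∈? B
    ... | yes v∈B = let (e , _ , e-rv) = spokeTo v∈B in cons e tt e-rv nil
    ... | no  v∉B = let (b , b∈B , f , f-vb) = dominating v v∉B
                        (e , _ , e-rb)       = spokeTo b∈B
                    in cons e tt e-rb (cons f tt (Joins-sym f-vb) nil)

    ∣T∣-even : ∣ T ∣ % 2 ≡ 0
    ∣T∣-even = subst (λ A → ∣ A ∣ % 2 ≡ 0) (∩-identityˡ T)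
      (graft ⊤ (r , ∈⊤ , λ v → (λ _ → walkFromCentre v) , (λ _ → ∈⊤)))

    T≡B∪⁅r⁆ : r ∈ T → T ≡ B ∪ ⁅ r ⁆
    T≡B∪⁅r⁆ r∈T = ⊆-antisym
      (λ {v} v∈T → x∈p∪q⁺ (case v ≟ r of λ
        { (yes refl) → inj₂ (x∈⁅x⁆ r)
        ; (no v≢r)   → inj₁ (T∖r⊆B v∈T v≢r) }))
      (λ v∈B∪r → case x∈p∪q⁻ B ⁅ r ⁆ v∈B∪r of λ
        { (inj₁ v∈B)   → B⊆T v∈B
        ; (inj₂ v∈⁅r⁆) → subst (_∈ T) (sym (x∈⁅y⁆⇒x≡y r v∈⁅r⁆)) r∈T })

    T≡B : r ∉ T → T ≡ B
    T≡B r∉T = ⊆-antisym (λ v∈T → T∖r⊆B v∈T λ { refl → r∉T v∈T }) B⊆T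

    T-parity : (∣ B ∣ % 2 ≡ 1 → T ≡ B ∪ ⁅ r ⁆) × (∣ B ∣ % 2 ≡ 0 → T ≡ B)
    T-parity with r ∈? T
    ... | yes r∈T = (λ _ → T≡B∪⁅r⁆ r∈T) , λ ∣B∣-even → ⊥-elim (even-suc⇒¬even ∣ B ∣
      (subst (λ k → k % 2 ≡ 0) (trans (cong ∣_∣ (T≡B∪⁅r⁆ r∈T)) (∣p∪⁅x⁆∣≡1+∣p∣ r∉B)) ∣T∣-even) ∣B∣-even)
    ... | no  r∉T =
      (λ ∣B∣-odd → case trans (sym ∣B∣-odd) (subst (λ A → ∣ A ∣ % 2 ≡ 0) (T≡B r∉T) ∣T∣-even) of λ ()) ,
      (λ _ → T≡B r∉T)

  module RakeStar {T r B} (B⊆T : B ⊆ T) (stable : Stable G B) (dominating : NeighbourhoodIsComplement G B)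
    (r∉B : r ∉ B) (adjacent : ∀ b → b ∈ B → Adjacent G r b)
    (T-odd : ∣ B ∣ % 2 ≡ 1 → T ≡ B ∪ ⁅ r ⁆) (T-even : ∣ B ∣ % 2 ≡ 0 → T ≡ B) where

    -- one canonical edge from r to each b, so that the set of chosen edges is decidable
    spokeOf : Fin n → Maybe (Fin (m G))
    spokeOf b with any? (λ e → joins? e r b)
    ... | yes (e , _) = just e
    ... | no  _       = nothing

    spokeOf-joins : ∀ {b e} → spokeOf b ≡ just e → Joins G e r b
    spokeOf-joins {b} eq with any? (λ e → joins? e r b)
    ... | yes (_ , e'-rb) = subst (λ e → Joins G e r b) (just-injective eq) e'-rb

    spokeOf-defined : ∀ {b} → Adjacent G r b → ∃[ e ] spokeOf b ≡ just e
    spokeOf-defined {b} r-b with any? (λ e → joins? e r b)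
    ... | yes (e , _) = e , refl
    ... | no  ¬r-b    = contradiction r-b ¬r-b

    IsSpoke : Fin (m G) → Set
    IsSpoke e = ∃[ b ] (b ∈ B × spokeOf b ≡ just e)

    isSpoke? : Decidable IsSpoke
    isSpoke? e = any? λ b → b ∈? B ×-dec maybe-≡-dec _≟_ (spokeOf b) (just e)

    spokes : EdgeSet G
    spokes = satisfying isSpoke?

    spokes-isStar : IsStar r B spokes
    spokes-isStar = record { spoke = spoke ; spokeTo = spokeTo ; spoke-unique = spoke-unique }
      where
      spoke-of : ∀ {e} → e ∈ spokes → IsSpoke e
      spoke-of = Equivalence.to (∈satisfying⇔ isSpoke?)
      spoke : ∀ {e} → e ∈ spokes → ∃[ b ] (b ∈ B × Joins G e r b)
      spoke e∈ = let (b , b∈B , eq) = spoke-of e∈ in b , b∈B , spokeOf-joins eq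
      spokeTo : ∀ {b} → b ∈ B → ∃[ e ] (e ∈ spokes × Joins G e r b)
      spokeTo b∈B = let (e , eq) = spokeOf-defined (adjacent _ b∈B)
                    in e , Equivalence.from (∈satisfying⇔ isSpoke?) (_ , b∈B , eq) , spokeOf-joins eq
      spoke-unique : ∀ {e e' b} → e ∈ spokes → e' ∈ spokes → Joins G e r b → Joins G e' r b → e ≡ e'
      spoke-unique e∈ e'∈ e-rb e'-rb with spoke-of e∈ | spoke-of e'∈
      ... | b₁ , b₁∈B , eq₁ | b₂ , b₂∈B , eq₂
        with Joins-unique-end (λ { refl → r∉B b₁∈B }) (spokeOf-joins eq₁) e-rb
           | Joins-unique-end (λ { refl → r∉B b₂∈B }) (spokeOf-joins eq₂) e'-rb
      ... | refl | refl = just-injective (trans (sym eq₁) eq₂)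

    open Star r∉B spokes-isStar

    centre-parity : (r ∈ T → ∣ B ∣ % 2 ≡ 1) × (r ∉ T → ∣ B ∣ % 2 ≡ 0)
    centre-parity with parity ∣ B ∣
    ... | inj₁ even = (λ r∈T → contradiction (subst (r ∈_) (T-even even) r∈T) r∉B) , (λ _ → even)
    ... | inj₂ odd  = (λ _ → odd) , λ r∉T →
      contradiction (subst (r ∈_) (sym (T-odd odd)) (x∈p∪q⁺ (inj₂ (x∈⁅x⁆ r)))) r∉T

    T∖r⊆B : ∀ {v} → v ∈ T → v ≢ r → v ∈ B
    T∖r⊆B {v} v∈T v≢r with parity ∣ B ∣
    ... | inj₁ even = subst (v ∈_) (T-even even) v∈T
    ... | inj₂ odd  = case x∈p∪q⁻ B ⁅ r ⁆ (subst (v ∈_) (T-odd odd) v∈T) of λ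
      { (inj₁ v∈B)   → v∈B
      ; (inj₂ v∈⁅r⁆) → contradiction (x∈⁅y⁆⇒x≡y r v∈⁅r⁆) v≢r }

    spokes-isJoin : IsJoin G T spokes
    spokes-isJoin v with v ≟ r
    ... | yes refl = (λ r∈T → trans (cong (_% 2) degree-centre) (proj₁ centre-parity r∈T))
                   , (λ r∉T → trans (cong (_% 2) degree-centre) (proj₂ centre-parity r∉T))
    ... | no  v≢r with v ∈? B
    ...   | yes v∈B = (λ _ → cong (_% 2) (degree-leaf v∈B)) , (λ v∉T → contradiction (B⊆T v∈B) v∉T)
    ...   | no  v∉B = (λ v∈T → contradiction (T∖r⊆B v∈T v≢r) v∉B)
                    , (λ _ → cong (_% 2) (degree-other v∉B v≢r))

    spokes-isMinJoin : IsMinJoin G T spokes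
    spokes-isMinJoin = spokes-isJoin , λ F join →
      subst (_≤ ∣ F ∣) (sym size) (stable⇒∣B∣≤∣F∣ {T} {B} {F} stable B⊆T join)

    B-nonempty : Nonempty B
    B-nonempty = let (b , b∈B , _) = dominating r r∉B in b , b∈B

mainTheorem7 : ∀ {n} (G : Graph n) (T : Subset n) → IsGraft G T →
    (r : Fin n) (B : Subset n) → IsStrongComb G T r B →
    (∃[ F ] (IsMinJoin G T F × IsConnectedEdgeSet G F × Covers G F r))
      ⇔ IsRake G T r B
mainTheorem7 G T graft r B (stable , dominating , r∉B , dist-B , dist-rest) = mk⇔ rake spokes-of-rake
  where
  rake : ∃[ F ] (IsMinJoin G T F × IsConnectedEdgeSet G F × Covers G F r) → IsRake G T r B
  rake (F , minJoin , F-connected , r-covered) =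
    B⊆T , stable , dominating , r∉B , (λ _ b∈B → let (e , _ , e-rb) = spokeTo b∈B in e , e-rb) , T-parity
    where
    open StrongCombJoin G r∉B dist-B dist-rest minJoin F-connected r-covered
    open StarJoin G graft r∉B dominating isStar (proj₁ minJoin)

  spokes-of-rake : IsRake G T r B → ∃[ F ] (IsMinJoin G T F × IsConnectedEdgeSet G F × Covers G F r)
  spokes-of-rake (B⊆T , stable , dominating , r∉B , adjacent , T-odd , T-even) =
    spokes , spokes-isMinJoin , connected B-nonempty , covers-centre B-nonempty
    where
    open RakeStar G B⊆T stable dominating r∉B adjacent T-odd T-even
    open Star G r∉B spokes-isStar
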